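{- Let $F$ be a subgraph of the complete bipartite graph $K_{a,b}$ with vertex partition $A \cup B$, $|A|=a$, $|B|=b$, such that exactly $r < \max\{a, b\}$ edges of $K_{a,b}$ are missing from $F$. Suppose $F$ has vertices $x \in A$ and $y \in B$ with $x$ adjacent to all of $B$ and $y$ adjacent to all of $A$. Then the number of proper 3-colorings of $F$ is exactly $3 \cdot 2^a + 3 \cdot 2^b - 6 + 6s$, where $s$ is the number of nonempty subsets of the set of missing edges which form (the edge set of) a complete bipartite graph. This number is at most $3 \cdot 2^a + 3 \cdot 2^b + 6 \cdot (2^r-2)$, with equality exactly when the missing edges form a star.
   Context: A proper 3-coloring assigns one of 3 colors to each vertex so that adjacent vertices get different colors. Missing edges are the edges of $K_{a,b}$ not in $F$. A star is a set of edges all sharing a common endpoint. -}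

module Defs where

open import Data.Bool using (Bool; true; false; _≟_)
open import Data.Nat using (ℕ; zero; suc)
open import Data.Fin using (Fin)
open import Data.Fin.Properties as FinP using (all?; any?)
open import Data.Vec using (Vec; []; _∷_; lookup)
open import Data.List using (List; []; _∷_; map; concatMap; length; filter; cartesianProduct; allFin)
open import Data.List.Relation.Unary.Any as Any using (Any)
open import Data.Product using (Σ; ∃; _×_; _,_; proj₁; proj₂)
open import Data.Sum using (_⊎_)
open import Relation.Nullary using (¬_; Dec; yes; no)
open import Relation.Nullary.Decidable using (_×-dec_; _⊎-dec_; ¬?)
open import Relation.Binary.PropositionalEquality using (_≡_)
open import Function using (_⇔_)
open import Data.Empty using (⊥)
open import Function.Properties.Equivalence using ()

-- A subgraph F of K_{a,b}: A = Fin a, B = Fin b, F i j = true iff ij is an edge of F.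
Graph : ℕ → ℕ → Set
Graph a b = Fin a → Fin b → Bool

module _ {a b : ℕ} (F : Graph a b) where

  Edge : Fin a → Fin b → Set
  Edge i j = F i j ≡ true

  Missing : Fin a → Fin b → Set
  Missing i j = F i j ≡ false

allVecs : {A : Set} → List A → (n : ℕ) → List (Vec A n)
allVecs xs zero = [] ∷ []
allVecs xs (suc n) = concatMap (λ x → map (x ∷_) (allVecs xs n)) xs

bools : List Bool
bools = true ∷ false ∷ []

Coloring : ℕ → ℕ → Set
Coloring a b = Vec (Fin 3) a × Vec (Fin 3) b

allColorings : (a b : ℕ) → List (Coloring a b)
allColorings a b = cartesianProduct (allVecs (allFin 3) a) (allVecs (allFin 3) b)

Proper : {a b : ℕ} → Graph a b → Coloring a b → Set
Proper F (c , d) = ∀ i j → Edge F i j → ¬ (lookup c i ≡ lookup d j)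

proper? : {a b : ℕ} (F : Graph a b) (cd : Coloring a b) → Dec (Proper F cd)
proper? F (c , d) = all? λ i → all? λ j → edge→ (F i j)
  where
  edge→ : ∀ {i j} (e : Bool) → Dec (e ≡ true → ¬ (lookup c i ≡ lookup d j))
  edge→ {i} {j} false = yes λ ()
  edge→ {i} {j} true with lookup c i FinP.≟ lookup d j
  ... | yes p = no λ h → h _≡_.refl p
  ... | no np = yes λ _ → np

numColorings : {a b : ℕ} → Graph a b → ℕ
numColorings {a} {b} F = length (filter (proper? F) (allColorings a b))

numMissing : {a b : ℕ} → Graph a b → ℕ
numMissing {a} {b} F =
  length (filter (λ p → F (proj₁ p) (proj₂ p) ≟ false) (cartesianProduct (allFin a) (allFin b)))

EdgeSet : ℕ → ℕ → Set
EdgeSet a b = Vec (Vec Bool b) a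

InS : {a b : ℕ} → EdgeSet a b → Fin a → Fin b → Set
InS S i j = lookup (lookup S i) j ≡ true

In : {n : ℕ} → Vec Bool n → Fin n → Set
In X i = lookup X i ≡ true

NonemptyV : {n : ℕ} → Vec Bool n → Set
NonemptyV X = ∃ λ i → In X i

IsCompleteBipartite : {a b : ℕ} → EdgeSet a b → Set
IsCompleteBipartite {a} {b} S =
  Any (λ X → Any (λ Y → NonemptyV X × NonemptyV Y ×
         (∀ i j → InS S i j ⇔ (In X i × In Y j))) (allVecs bools b)) (allVecs bools a)

Counted : {a b : ℕ} → Graph a b → EdgeSet a b → Set
Counted F S =
  (∀ i j → InS S i j → Missing F i j) × (∃ λ i → ∃ λ j → InS S i j) × IsCompleteBipartite S

private
  open import Data.Empty using (⊥-elim)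
  open import Function.Bundles using (mk⇔; Equivalence)
  iff? : {P Q : Set} → Dec P → Dec Q → Dec (P ⇔ Q)
  iff? (yes p) (yes q) = yes (mk⇔ (λ _ → q) (λ _ → p))
  iff? (yes p) (no nq) = no λ e → nq (Equivalence.to e p)
  iff? (no np) (yes q) = no λ e → np (Equivalence.from e q)
  iff? (no np) (no nq) = yes (mk⇔ (λ p → ⊥-elim (np p)) (λ q → ⊥-elim (nq q)))

counted? : {a b : ℕ} (F : Graph a b) (S : EdgeSet a b) → Dec (Counted F S)
counted? {a} {b} F S =
  (all? λ i → all? λ j → imp (lookup (lookup S i) j) (F i j))
  ×-dec (any? λ i → any? λ j → lookup (lookup S i) j ≟ true)
  ×-dec Any.any? (λ X → Any.any? (λ Y →
          (any? λ i → lookup X i ≟ true) ×-dec (any? λ j → lookup Y j ≟ true) ×-dec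
          (all? λ i → all? λ j → iff? (lookup (lookup S i) j ≟ true)
                                     ((lookup X i ≟ true) ×-dec (lookup Y j ≟ true))))
          (allVecs bools b)) (allVecs bools a)
  where
  imp : (u v : Bool) → Dec (u ≡ true → v ≡ false)
  imp false v = yes λ ()
  imp true false = yes λ _ → _≡_.refl
  imp true true = no λ h → tf (h _≡_.refl)
    where tf : true ≡ false → ⊥
          tf ()

numBipartiteSubsets : {a b : ℕ} → Graph a b → ℕ
numBipartiteSubsets {a} {b} F = length (filter (counted? F) (allVecs (allVecs bools b) a))

MissingIsStar : {a b : ℕ} → Graph a b → Set
MissingIsStar {a} {b} F =
  (∃ λ (x : Fin a) → ∀ i j → Missing F i j → i ≡ x)
  ⊎ (∃ λ (y : Fin b) → ∀ i j → Missing F i j → j ≡ y)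

-- In a proper 3-colouring (c, d) let α = c x and β = d y; they differ because xy is an edge.
-- Every vertex of A is adjacent to y and every vertex of B to x, so A is coloured from {α, γ}
-- and B from {β, γ}, γ being the third colour. The colouring is therefore determined by (α, β)
-- and the γ-classes X ⊆ A ∖ {x}, Y ⊆ B ∖ {y}, and it is proper exactly when X × Y consists of
-- missing edges. There are 2^(a-1) + 2^(b-1) - 1 such pairs with X or Y empty, and those with
-- both nonempty correspond to the complete bipartite sets X × Y of missing edges, so the count is
-- 6 (2^(a-1) + 2^(b-1) - 1 + s). A nonempty set of edges is complete bipartite iff it is
-- "rectangular" (ij′, i′j ∈ S ⇒ ij ∈ S), so s is at most the number 2^r - 1 of nonempty sets of
-- missing edges, with equality iff no two missing edges are disjoint, i.e. iff they form a star.

module Submission where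

open import Defs

module Counting where

  open import Data.Bool using (Bool; true; false; if_then_else_) renaming (_≟_ to _≟ᵇ_)
  open import Data.Bool.Properties using (¬-not; not-¬)
  open import Data.Empty using (⊥; ⊥-elim)
  open import Data.Unit using (tt)
  open import Data.Fin using (Fin) renaming (zero to fzero; suc to fsuc)
  open import Data.Fin.Properties using (all?; any?; injective⇒≤) renaming (_≟_ to _≟ᶠ_)
  open import Data.List
    using (List; []; _∷_; _++_; map; concatMap; length; filter; cartesianProduct; cartesianProductWith; allFin)
  open import Data.List.Properties using (filter-++; length-++; filter-none; filter-some; map-tabulate)
  open import Data.List.Membership.Propositional using (_∈_)
  open import Data.List.Membership.Propositional.Properties
    using (∈-cartesianProductWith⁺; ∈-cartesianProduct⁺; ∈-filter⁺; ∈-filter⁻; ∈-lookup; ∈-allFin)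
  import Data.List.Relation.Unary.All as All
  open import Data.List.Relation.Unary.Any using (here; there)
  import Data.List.Relation.Unary.Any as Any
  open import Data.List.Relation.Unary.Any.Properties using (lookup-index)
  open import Data.List.Relation.Unary.AllPairs using ([]; _∷_)
  open import Data.List.Relation.Unary.Unique.Propositional using (Unique)
  import Data.List.Relation.Unary.Unique.Propositional.Properties as Unique
  open import Data.Nat using (ℕ; zero; suc; _+_; _*_; _^_; _≤_)
  open import Data.Nat.Properties
  open import Data.Nat.Tactic.RingSolver using (solve-∀)
  open import Data.Product using (∃; _×_; _,_; proj₁; proj₂; map₁)
  open import Data.Sum using (_⊎_; inj₁; inj₂; [_,_]′)
  open import Data.Vec using (Vec; []; _∷_; lookup)
  import Data.Vec as Vec
  import Data.Vec.Properties as VecP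
  open import Data.Vec.Relation.Binary.Pointwise.Extensional using (ext; Pointwise-≡⇒≡)
  open import Function using (_∘_; _⇔_; id)
  open import Function.Bundles using (Equivalence; mk⇔)
  open import Relation.Binary.PropositionalEquality
  open import Relation.Nullary using (¬_; Dec; yes; no; does)
  open import Relation.Nullary.Decidable
    using (_×-dec_; _⊎-dec_; _→-dec_; ¬?; decidable-stable; toWitness; dec-true; dec-false)
  open import Level using (0ℓ)
  open import Relation.Unary using (Decidable; Pred)
  open import Relation.Unary.Properties using (_∩?_; ∁?; ∅?; U?)

  private variable
    A B C : Set

  -- Counting along lists

  count : {P : Pred A 0ℓ} → Decidable P → List A → ℕ
  count P? xs = length (filter P? xs)

  module _ {P : Pred A 0ℓ} (P? : Decidable P) where

    count-++ : ∀ xs ys → count P? (xs ++ ys) ≡ count P? xs + count P? ys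
    count-++ xs ys = trans (cong length (filter-++ P? xs ys)) (length-++ (filter P? xs))

    count-map : (f : B → A) (xs : List B) → count P? (map f xs) ≡ count (P? ∘ f) xs
    count-map f [] = refl
    count-map f (x ∷ xs) with does (P? (f x))
    ... | true = cong suc (count-map f xs)
    ... | false = count-map f xs

    count-none : ∀ xs → (∀ x → ¬ P x) → count P? xs ≡ 0
    count-none xs ¬P = cong length (filter-none P? (All.universal ¬P xs))

    count-partition : {R : Pred A 0ℓ} (R? : Decidable R) (xs : List A) →
      count P? xs ≡ count (P? ∩? R?) xs + count (P? ∩? ∁? R?) xs
    count-partition R? [] = refl
    count-partition R? (x ∷ xs) with P? x | R? x
    ... | yes _ | yes _ = cong suc (count-partition R? xs)
    ... | yes _ | no _ = trans (cong suc (count-partition R? xs)) (sym (+-suc _ _))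
    ... | no _ | yes _ = count-partition R? xs
    ... | no _ | no _ = count-partition R? xs

  count-cong : {P Q : Pred A 0ℓ} (P? : Decidable P) (Q? : Decidable Q) (xs : List A) →
    (∀ {x} → x ∈ xs → P x ⇔ Q x) → count P? xs ≡ count Q? xs
  count-cong P? Q? [] P⇔Q = refl
  count-cong P? Q? (x ∷ xs) P⇔Q with P? x | Q? x
  ... | yes _ | yes _ = cong suc (count-cong P? Q? xs (P⇔Q ∘ there))
  ... | yes p | no ¬q = ⊥-elim (¬q (Equivalence.to (P⇔Q (here refl)) p))
  ... | no ¬p | yes q = ⊥-elim (¬p (Equivalence.from (P⇔Q (here refl)) q))
  ... | no _ | no _ = count-cong P? Q? xs (P⇔Q ∘ there)

  module _ {P Q : Pred A 0ℓ} (P? : Decidable P) (Q? : Decidable Q) (xs : List A)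
           (P⊆Q : ∀ {x} → x ∈ xs → P x → Q x) where

    private
      count-P≡count-Q∩P : count P? xs ≡ count (Q? ∩? P?) xs
      count-P≡count-Q∩P = count-cong P? (Q? ∩? P?) xs λ x∈ → mk⇔ (λ p → P⊆Q x∈ p , p) proj₂

    count-mono : count P? xs ≤ count Q? xs
    count-mono = begin
      count P? xs                                          ≡⟨ count-P≡count-Q∩P ⟩
      count (Q? ∩? P?) xs                                  ≤⟨ m≤m+n _ _ ⟩
      count (Q? ∩? P?) xs + count (Q? ∩? ∁? P?) xs        ≡⟨ count-partition Q? P? xs ⟨
      count Q? xs                                          ∎
      where open ≤-Reasoning

    count-mono-≡⇒⊇ : count P? xs ≡ count Q? xs → ∀ {x} → x ∈ xs → Q x → P x
    count-mono-≡⇒⊇ eq {x} x∈ q = decidable-stable (P? x) λ ¬p →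
      <-irrefl (sym nothing-in-Q∖P) (filter-some (Q? ∩? ∁? P?) (Any.map (λ { refl → q , ¬p }) x∈))
      where
      nothing-in-Q∖P : count (Q? ∩? ∁? P?) xs ≡ 0
      nothing-in-Q∖P = +-cancelˡ-≡ (count (Q? ∩? P?) xs) _ 0 (begin
        count (Q? ∩? P?) xs + count (Q? ∩? ∁? P?) xs  ≡⟨ count-partition Q? P? xs ⟨
        count Q? xs                                   ≡⟨ eq ⟨
        count P? xs                                   ≡⟨ count-P≡count-Q∩P ⟩
        count (Q? ∩? P?) xs                           ≡⟨ +-identityʳ _ ⟨
        count (Q? ∩? P?) xs + 0                       ∎)
        where open ≡-Reasoning

  count-cartesianProductWith : {P : Pred A 0ℓ} {Q : Pred B 0ℓ} {R : Pred C 0ℓ}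
    (P? : Decidable P) (Q? : Decidable Q) (R? : Decidable R) (f : A → B → C) →
    (∀ x y → R (f x y) ⇔ (P x × Q y)) →
    ∀ xs ys → count R? (cartesianProductWith f xs ys) ≡ count P? xs * count Q? ys
  count-cartesianProductWith P? Q? R? f R⇔P×Q [] ys = refl
  count-cartesianProductWith P? Q? R? f R⇔P×Q (x ∷ xs) ys
    rewrite count-++ R? (map (f x) ys) (cartesianProductWith f xs ys)
          | count-map R? (f x) ys
          | count-cartesianProductWith P? Q? R? f R⇔P×Q xs ys
    with P? x
  ... | yes p = cong (_+ _) (count-cong (R? ∘ f x) Q? ys λ _ →
                  mk⇔ (proj₂ ∘ Equivalence.to (R⇔P×Q x _)) (λ q → Equivalence.from (R⇔P×Q x _) (p , q)))
  ... | no ¬p = cong (_+ _) (count-none (R? ∘ f x) ys λ y r → ¬p (proj₁ (Equivalence.to (R⇔P×Q x y) r)))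

  count-cartesianProduct : {P : Pred A 0ℓ} {Q : Pred B 0ℓ} (P? : Decidable P) (Q? : Decidable Q)
    (xs : List A) (ys : List B) →
    count (λ xy → P? (proj₁ xy) ×-dec Q? (proj₂ xy)) (cartesianProduct xs ys) ≡ count P? xs * count Q? ys
  count-cartesianProduct P? Q? = count-cartesianProductWith P? Q? _ _,_ λ _ _ → mk⇔ id id

  private
    lookup-injective : {xs : List A} → Unique xs → ∀ i j → Data.List.lookup xs i ≡ Data.List.lookup xs j → i ≡ j
    lookup-injective (_ ∷ _) fzero fzero _ = refl
    lookup-injective (x∉ ∷ _) fzero (fsuc j) eq = ⊥-elim (All.lookup x∉ (∈-lookup j) eq)
    lookup-injective (x∉ ∷ _) (fsuc i) fzero eq = ⊥-elim (All.lookup x∉ (∈-lookup i) (sym eq))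
    lookup-injective (_ ∷ u) (fsuc i) (fsuc j) eq = cong fsuc (lookup-injective u i j eq)

  length-≤-injection : (xs : List A) (ys : List B) → Unique xs → (f : A → B) (g : B → A) →
    (∀ {x} → x ∈ xs → f x ∈ ys) → (∀ {x} → x ∈ xs → g (f x) ≡ x) → length xs ≤ length ys
  length-≤-injection xs ys xs! f g f∈ gf≡ = injective⇒≤ {f = index} index-injective
    where
    index : Fin (length xs) → Fin (length ys)
    index i = Any.index (f∈ (∈-lookup i))
    index-injective : ∀ {i j} → index i ≡ index j → i ≡ j
    index-injective {i} {j} eq = lookup-injective xs! i j (begin
      Data.List.lookup xs i                        ≡⟨ gf≡ (∈-lookup i) ⟨
      g (f (Data.List.lookup xs i))                ≡⟨ cong g (lookup-index (f∈ (∈-lookup i))) ⟩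
      g (Data.List.lookup ys (index i))            ≡⟨ cong (g ∘ Data.List.lookup ys) eq ⟩
      g (Data.List.lookup ys (index j))            ≡⟨ cong g (lookup-index (f∈ (∈-lookup j))) ⟨
      g (f (Data.List.lookup xs j))                ≡⟨ gf≡ (∈-lookup j) ⟩
      Data.List.lookup xs j                        ∎)
      where open ≡-Reasoning

  count-≤-injection : {P : Pred A 0ℓ} {Q : Pred B 0ℓ} (P? : Decidable P) (Q? : Decidable Q)
    (xs : List A) (ys : List B) (f : A → B) (g : B → A) → Unique xs →
    (∀ {x} → x ∈ xs → P x → f x ∈ ys × Q (f x) × g (f x) ≡ x) → count P? xs ≤ count Q? ys
  count-≤-injection P? Q? xs ys f g xs! into =
    length-≤-injection (filter P? xs) (filter Q? ys) (Unique.filter⁺ P? xs!) f g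
      (λ x∈ → let x∈xs , p = ∈-filter⁻ P? x∈ ; fx∈ , q , _ = into x∈xs p in ∈-filter⁺ Q? fx∈ q)
      (λ x∈ → let x∈xs , p = ∈-filter⁻ P? x∈ in proj₂ (proj₂ (into x∈xs p)))

  count-bijection : {P : Pred A 0ℓ} {Q : Pred B 0ℓ} (P? : Decidable P) (Q? : Decidable Q)
    (xs : List A) (ys : List B) (f : A → B) (g : B → A) → Unique xs → Unique ys →
    (∀ {x} → x ∈ xs → P x → f x ∈ ys × Q (f x) × g (f x) ≡ x) →
    (∀ {y} → y ∈ ys → Q y → g y ∈ xs × P (g y) × f (g y) ≡ y) → count P? xs ≡ count Q? ys
  count-bijection P? Q? xs ys f g xs! ys! into onto =
    ≤-antisym (count-≤-injection P? Q? xs ys f g xs! into) (count-≤-injection Q? P? ys xs g f ys! onto)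

  count-cartesianProduct-map₁ : {A′ : Set} {P : Pred (A′ × B) 0ℓ} (P? : Decidable P) (h : A → A′)
    (xs : List A) (ys : List B) →
    count P? (cartesianProduct (map h xs) ys) ≡ count (P? ∘ map₁ h) (cartesianProduct xs ys)
  count-cartesianProduct-map₁ P? h [] ys = refl
  count-cartesianProduct-map₁ P? h (x ∷ xs) ys = begin
    count P? (map (h x ,_) ys ++ cartesianProduct (map h xs) ys)
      ≡⟨ count-++ P? (map (h x ,_) ys) _ ⟩
    count P? (map (h x ,_) ys) + count P? (cartesianProduct (map h xs) ys)
      ≡⟨ cong₂ _+_ (trans (count-map P? (h x ,_) ys) (sym (count-map (P? ∘ map₁ h) (x ,_) ys)))
                   (count-cartesianProduct-map₁ P? h xs ys) ⟩
    count (P? ∘ map₁ h) (map (x ,_) ys) + count (P? ∘ map₁ h) (cartesianProduct xs ys)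
      ≡⟨ count-++ (P? ∘ map₁ h) (map (x ,_) ys) _ ⟨
    count (P? ∘ map₁ h) (map (x ,_) ys ++ cartesianProduct xs ys) ∎
    where open ≡-Reasoning

  allFin-suc : ∀ n → allFin (suc n) ≡ fzero ∷ map fsuc (allFin n)
  allFin-suc n = cong (fzero ∷_) (sym (map-tabulate (λ i → i) fsuc))

  concatMap-map≡cartesianProductWith : (f : A → B → C) (xs : List A) (ys : List B) →
    concatMap (λ x → map (f x) ys) xs ≡ cartesianProductWith f xs ys
  concatMap-map≡cartesianProductWith f [] ys = refl
  concatMap-map≡cartesianProductWith f (x ∷ xs) ys = cong (map (f x) ys ++_) (concatMap-map≡cartesianProductWith f xs ys)

  allVecs-suc : (xs : List A) (n : ℕ) → allVecs xs (suc n) ≡ cartesianProductWith _∷_ xs (allVecs xs n)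
  allVecs-suc xs n = concatMap-map≡cartesianProductWith _∷_ xs (allVecs xs n)

  ∈-allVecs : {xs : List A} → (∀ x → x ∈ xs) → ∀ {n} (v : Vec A n) → v ∈ allVecs xs n
  ∈-allVecs all∈ [] = here refl
  ∈-allVecs {xs = xs} all∈ {suc n} (x ∷ v) =
    subst (_ ∈_) (sym (allVecs-suc xs n)) (∈-cartesianProductWith⁺ _∷_ (all∈ x) (∈-allVecs all∈ v))

  allVecs-unique : {xs : List A} → Unique xs → ∀ n → Unique (allVecs xs n)
  allVecs-unique xs! zero = All.[] ∷ []
  allVecs-unique {xs = xs} xs! (suc n) = subst Unique (sym (allVecs-suc xs n))
    (Unique.cartesianProductWith⁺ _∷_ VecP.∷-injective xs! (allVecs-unique xs! n))

  count-allVecs-suc : ∀ {n} {P : Pred A 0ℓ} {Q : Pred (Vec A n) 0ℓ} {R : Pred (Vec A (suc n)) 0ℓ}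
    (P? : Decidable P) (Q? : Decidable Q) (R? : Decidable R) → (∀ x v → R (x ∷ v) ⇔ (P x × Q v)) →
    ∀ xs → count R? (allVecs xs (suc n)) ≡ count P? xs * count Q? (allVecs xs n)
  count-allVecs-suc {n = n} P? Q? R? R⇔P×Q xs =
    trans (cong (count R?) (allVecs-suc xs n)) (count-cartesianProductWith P? Q? R? _∷_ R⇔P×Q xs (allVecs xs n))

  -- Subsets of Fin n and sets of edges as Boolean vectors

  ∈-bools : ∀ u → u ∈ bools
  ∈-bools true = here refl
  ∈-bools false = there (here refl)

  bools-unique : Unique bools
  bools-unique = ((λ ()) All.∷ All.[]) ∷ All.[] ∷ []

  count-allFin-suc : ∀ {n} {P : Pred (Fin (suc n)) 0ℓ} (P? : Decidable P) →
    count P? (allFin (suc n)) ≡ count P? (fzero ∷ []) + count (P? ∘ fsuc) (allFin n)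
  count-allFin-suc {n} P? = begin
    count P? (allFin (suc n))                                 ≡⟨ cong (count P?) (allFin-suc n) ⟩
    count P? (fzero ∷ map fsuc (allFin n))                    ≡⟨ count-++ P? (fzero ∷ []) _ ⟩
    count P? (fzero ∷ []) + count P? (map fsuc (allFin n))
      ≡⟨ cong (count P? (fzero ∷ []) +_) (count-map P? fsuc (allFin n)) ⟩
    count P? (fzero ∷ []) + count (P? ∘ fsuc) (allFin n)      ∎
    where open ≡-Reasoning

  In? : ∀ {n} (X : Vec Bool n) → Decidable (In X)
  In? X i = lookup X i ≟ᵇ true

  _⊆ᵛ_ : ∀ {n} → Vec Bool n → Pred (Fin n) 0ℓ → Set
  X ⊆ᵛ Z = ∀ j → In X j → Z j

  ⊆ᵛ? : ∀ {n} {Z : Pred (Fin n) 0ℓ} → Decidable Z → Decidable (_⊆ᵛ Z)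
  ⊆ᵛ? Z? X = all? λ j → In? X j →-dec Z? j

  count-subsets : ∀ n {Z : Pred (Fin n) 0ℓ} (Z? : Decidable Z) →
    count (⊆ᵛ? Z?) (allVecs bools n) ≡ 2 ^ count Z? (allFin n)
  count-subsets zero Z? = refl
  count-subsets (suc n) {Z} Z? = begin
    count (⊆ᵛ? Z?) (allVecs bools (suc n))
      ≡⟨ count-allVecs-suc head? (⊆ᵛ? (Z? ∘ fsuc)) (⊆ᵛ? Z?) ⊆⇔head×tail bools ⟩
    count head? bools * count (⊆ᵛ? (Z? ∘ fsuc)) (allVecs bools n)
      ≡⟨ cong₂ _*_ count-head (count-subsets n (Z? ∘ fsuc)) ⟩
    2 ^ count Z? (fzero ∷ []) * 2 ^ count (Z? ∘ fsuc) (allFin n)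
      ≡⟨ ^-distribˡ-+-* 2 (count Z? (fzero ∷ [])) (count (Z? ∘ fsuc) (allFin n)) ⟨
    2 ^ (count Z? (fzero ∷ []) + count (Z? ∘ fsuc) (allFin n))
      ≡⟨ cong (2 ^_) (count-allFin-suc Z?) ⟨
    2 ^ count Z? (allFin (suc n)) ∎
    where
    open ≡-Reasoning
    head? : Decidable (λ u → u ≡ true → Z fzero)
    head? u = (u ≟ᵇ true) →-dec Z? fzero
    ⊆⇔head×tail : ∀ u X → (u ∷ X) ⊆ᵛ Z ⇔ ((u ≡ true → Z fzero) × X ⊆ᵛ (Z ∘ fsuc))
    ⊆⇔head×tail u X = mk⇔ (λ ⊆Z → ⊆Z fzero , ⊆Z ∘ fsuc) λ { (h , t) fzero → h ; (h , t) (fsuc j) → t j }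
    count-head : count (λ u → (u ≟ᵇ true) →-dec Z? fzero) bools ≡ 2 ^ count Z? (fzero ∷ [])
    count-head with Z? fzero
    ... | yes _ = refl
    ... | no _ = refl

  _⊆ᴱ_ : ∀ {a b} → EdgeSet a b → (Fin a → Fin b → Set) → Set
  S ⊆ᴱ Z = ∀ i → lookup S i ⊆ᵛ Z i

  ⊆ᴱ? : ∀ {a b} {Z : Fin a → Fin b → Set} → (∀ i → Decidable (Z i)) → Decidable (_⊆ᴱ Z)
  ⊆ᴱ? Z? S = all? λ i → ⊆ᵛ? (Z? i) (lookup S i)

  count-edgeSubsets : ∀ a b {Z : Fin a → Fin b → Set} (Z? : ∀ i → Decidable (Z i)) →
    count (⊆ᴱ? Z?) (allVecs (allVecs bools b) a)
      ≡ 2 ^ count (λ ij → Z? (proj₁ ij) (proj₂ ij)) (cartesianProduct (allFin a) (allFin b))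
  count-edgeSubsets zero b Z? = refl
  count-edgeSubsets (suc a) b {Z} Z? = begin
    count (⊆ᴱ? Z?) (allVecs (allVecs bools b) (suc a))
      ≡⟨ count-allVecs-suc (⊆ᵛ? (Z? fzero)) (⊆ᴱ? (Z? ∘ fsuc)) (⊆ᴱ? Z?) ⊆⇔head×tail (allVecs bools b) ⟩
    count (⊆ᵛ? (Z? fzero)) (allVecs bools b) * count (⊆ᴱ? (Z? ∘ fsuc)) (allVecs (allVecs bools b) a)
      ≡⟨ cong₂ _*_ (count-subsets b (Z? fzero)) (count-edgeSubsets a b (Z? ∘ fsuc)) ⟩
    2 ^ count (Z? fzero) (allFin b) * 2 ^ count Z?′ (cartesianProduct (allFin a) (allFin b))
      ≡⟨ ^-distribˡ-+-* 2 (count (Z? fzero) (allFin b)) _ ⟨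
    2 ^ (count (Z? fzero) (allFin b) + count Z?′ (cartesianProduct (allFin a) (allFin b)))
      ≡⟨ cong (2 ^_) split-first-row ⟨
    2 ^ count Z?² (cartesianProduct (allFin (suc a)) (allFin b)) ∎
    where
    open ≡-Reasoning
    Z?² : Decidable (λ (ij : Fin (suc a) × Fin b) → Z (proj₁ ij) (proj₂ ij))
    Z?² ij = Z? (proj₁ ij) (proj₂ ij)
    Z?′ : Decidable (λ (ij : Fin a × Fin b) → Z (fsuc (proj₁ ij)) (proj₂ ij))
    Z?′ = Z?² ∘ map₁ fsuc
    ⊆⇔head×tail : ∀ X S → (X ∷ S) ⊆ᴱ Z ⇔ (X ⊆ᵛ Z fzero × S ⊆ᴱ (Z ∘ fsuc))
    ⊆⇔head×tail X S = mk⇔ (λ ⊆Z → ⊆Z fzero , ⊆Z ∘ fsuc) λ { (h , t) fzero → h ; (h , t) (fsuc i) → t i }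
    split-first-row : count Z?² (cartesianProduct (allFin (suc a)) (allFin b))
                    ≡ count (Z? fzero) (allFin b) + count Z?′ (cartesianProduct (allFin a) (allFin b))
    split-first-row = begin
      count Z?² (cartesianProduct (allFin (suc a)) (allFin b))
        ≡⟨ cong (λ is → count Z?² (cartesianProduct is (allFin b))) (allFin-suc a) ⟩
      count Z?² (map (fzero ,_) (allFin b) ++ cartesianProduct (map fsuc (allFin a)) (allFin b))
        ≡⟨ count-++ Z?² (map (fzero ,_) (allFin b)) _ ⟩
      count Z?² (map (fzero ,_) (allFin b)) + count Z?² (cartesianProduct (map fsuc (allFin a)) (allFin b))
        ≡⟨ cong₂ _+_ (count-map Z?² (fzero ,_) (allFin b))
                     (count-cartesianProduct-map₁ Z?² fsuc (allFin a) (allFin b)) ⟩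
      count (Z? fzero) (allFin b) + count Z?′ (cartesianProduct (allFin a) (allFin b)) ∎

  does-true⇔ : {P : Set} (P? : Dec P) → does P? ≡ true ⇔ P
  does-true⇔ (yes p) = mk⇔ (λ _ → p) (λ _ → refl)
  does-true⇔ (no ¬p) = mk⇔ (λ ()) (⊥-elim ∘ ¬p)

  ≡true-ext : {u v : Bool} → u ≡ true ⇔ v ≡ true → u ≡ v
  ≡true-ext {true} u⇔v = sym (Equivalence.to u⇔v refl)
  ≡true-ext {false} {true} u⇔v = Equivalence.from u⇔v refl
  ≡true-ext {false} {false} _ = refl

  subset-ext : ∀ {n} {X Y : Vec Bool n} → (∀ i → In X i ⇔ In Y i) → X ≡ Y
  subset-ext X⇔Y = Pointwise-≡⇒≡ (ext (≡true-ext ∘ X⇔Y))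

  edgeSet-ext : ∀ {a b} {S S′ : EdgeSet a b} → (∀ i j → InS S i j ⇔ InS S′ i j) → S ≡ S′
  edgeSet-ext S⇔S′ = Pointwise-≡⇒≡ (ext λ i → subset-ext (S⇔S′ i))

  subset : ∀ {n} {Z : Pred (Fin n) 0ℓ} → Decidable Z → Vec Bool n
  subset Z? = Vec.tabulate (does ∘ Z?)

  In-subset : ∀ {n} {Z : Pred (Fin n) 0ℓ} (Z? : Decidable Z) i → In (subset Z?) i ⇔ Z i
  In-subset Z? i = subst (λ u → u ≡ true ⇔ _) (sym (VecP.lookup∘tabulate (does ∘ Z?) i)) (does-true⇔ (Z? i))

  edgeSet : ∀ {a b} {Z : Fin a → Fin b → Set} → (∀ i → Decidable (Z i)) → EdgeSet a b
  edgeSet Z? = Vec.tabulate (subset ∘ Z?)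

  InS-edgeSet : ∀ {a b} {Z : Fin a → Fin b → Set} (Z? : ∀ i → Decidable (Z i)) i j → InS (edgeSet Z?) i j ⇔ Z i j
  InS-edgeSet Z? i j = subst (λ X → In X j ⇔ _) (sym (VecP.lookup∘tabulate (subset ∘ Z?) i)) (In-subset (Z? i) j)

  NonemptyV? : ∀ {n} → Decidable (NonemptyV {n})
  NonemptyV? X = any? (In? X)

  NonemptyE : ∀ {a b} → EdgeSet a b → Set
  NonemptyE S = ∃ λ i → ∃ λ j → InS S i j

  NonemptyE? : ∀ {a b} → Decidable (NonemptyE {a} {b})
  NonemptyE? S = any? λ i → any? (In? (lookup S i))

  rowSupport : ∀ {a b} → EdgeSet a b → Vec Bool a
  rowSupport S = subset λ i → NonemptyV? (lookup S i)

  colSupport : ∀ {a b} → EdgeSet a b → Vec Bool b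
  colSupport S = subset λ j → any? λ i → In? (lookup S i) j

  outer : ∀ {a b} → Vec Bool a → Vec Bool b → EdgeSet a b
  outer X Y = edgeSet λ i j → In? X i ×-dec In? Y j

  -- Complete bipartite sets of edges and stars

  Rectangular : ∀ {a b} → EdgeSet a b → Set
  Rectangular S = ∀ {i i′ j j′} → InS S i j′ → InS S i′ j → InS S i j

  module _ {a b : ℕ} where

    In-rowSupport : (S : EdgeSet a b) (i : Fin a) → In (rowSupport S) i ⇔ (∃ λ j → InS S i j)
    In-rowSupport S = In-subset (λ i → NonemptyV? (lookup S i))

    In-colSupport : (S : EdgeSet a b) (j : Fin b) → In (colSupport S) j ⇔ (∃ λ i → InS S i j)
    In-colSupport S = In-subset (λ j → any? λ i → In? (lookup S i) j)

    InS-outer : (X : Vec Bool a) (Y : Vec Bool b) (i : Fin a) (j : Fin b) → InS (outer X Y) i j ⇔ (In X i × In Y j)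
    InS-outer X Y = InS-edgeSet (λ i j → In? X i ×-dec In? Y j)

    outer-rectangular : (X : Vec Bool a) (Y : Vec Bool b) → Rectangular (outer X Y)
    outer-rectangular X Y {i} {i′} {j} {j′} e e′ = Equivalence.from (InS-outer X Y i j)
      (proj₁ (Equivalence.to (InS-outer X Y i j′) e) , proj₂ (Equivalence.to (InS-outer X Y i′ j) e′))

    rectangular⇒outer-supports : (S : EdgeSet a b) → Rectangular S → S ≡ outer (rowSupport S) (colSupport S)
    rectangular⇒outer-supports S rect = edgeSet-ext λ i j → mk⇔
      (λ e → Equivalence.from (InS-outer (rowSupport S) (colSupport S) i j)
               (Equivalence.from (In-rowSupport S i) (j , e) , Equivalence.from (In-colSupport S j) (i , e)))
      (λ e → let r , c = Equivalence.to (InS-outer (rowSupport S) (colSupport S) i j) e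
                 j′ , e₁ = Equivalence.to (In-rowSupport S i) r
                 i′ , e₂ = Equivalence.to (In-colSupport S j) c
             in rect e₁ e₂)

    rowSupport-outer : (X : Vec Bool a) {Y : Vec Bool b} → NonemptyV Y → rowSupport (outer X Y) ≡ X
    rowSupport-outer X {Y} (j , j∈Y) = subset-ext λ i → mk⇔
      (λ r → let j′ , e = Equivalence.to (In-rowSupport (outer X Y) i) r
             in proj₁ (Equivalence.to (InS-outer X Y i j′) e))
      (λ i∈X → Equivalence.from (In-rowSupport (outer X Y) i) (j , Equivalence.from (InS-outer X Y i j) (i∈X , j∈Y)))

    colSupport-outer : {X : Vec Bool a} (Y : Vec Bool b) → NonemptyV X → colSupport (outer X Y) ≡ Y
    colSupport-outer {X} Y (i , i∈X) = subset-ext λ j → mk⇔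
      (λ c → let i′ , e = Equivalence.to (In-colSupport (outer X Y) j) c
             in proj₂ (Equivalence.to (InS-outer X Y i′ j) e))
      (λ j∈Y → Equivalence.from (In-colSupport (outer X Y) j) (i , Equivalence.from (InS-outer X Y i j) (i∈X , j∈Y)))

    isCompleteBipartite⇔nonempty×rectangular : (S : EdgeSet a b) → IsCompleteBipartite S ⇔ (NonemptyE S × Rectangular S)
    isCompleteBipartite⇔nonempty×rectangular S = mk⇔ to from
      where
      to : IsCompleteBipartite S → NonemptyE S × Rectangular S
      to cb with _ , anyY ← Any.satisfied cb with _ , (i , i∈X) , (j , j∈Y) , S⇔X×Y ← Any.satisfied anyY =
        (i , j , Equivalence.from (S⇔X×Y i j) (i∈X , j∈Y)) ,
        λ {i} {i′} {j} {j′} e e′ → Equivalence.from (S⇔X×Y i j)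
          (proj₁ (Equivalence.to (S⇔X×Y i j′) e) , proj₂ (Equivalence.to (S⇔X×Y i′ j) e′))
      from : NonemptyE S × Rectangular S → IsCompleteBipartite S
      from ((i , j , e) , rect) =
        Any.map (λ { refl → Any.map (λ { refl → nonempty-rows , nonempty-cols , S⇔rows×cols })
                                    (∈-allVecs ∈-bools (colSupport S)) })
                (∈-allVecs ∈-bools (rowSupport S))
        where
        nonempty-rows : NonemptyV (rowSupport S)
        nonempty-rows = i , Equivalence.from (In-rowSupport S i) (j , e)
        nonempty-cols : NonemptyV (colSupport S)
        nonempty-cols = j , Equivalence.from (In-colSupport S j) (i , e)
        S⇔rows×cols : ∀ i j → InS S i j ⇔ (In (rowSupport S) i × In (colSupport S) j)
        S⇔rows×cols i j = subst (λ S′ → InS S′ i j ⇔ (In (rowSupport S) i × In (colSupport S) j))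
          (sym (rectangular⇒outer-supports S rect)) (InS-outer (rowSupport S) (colSupport S) i j)

  module _ {a b : ℕ} (F : Graph a b) where

    Missing? : ∀ i → Decidable (Missing F i)
    Missing? i j = F i j ≟ᵇ false

    PairwiseIncident : Set
    PairwiseIncident = ∀ {p p′ q q′} → Missing F p q → Missing F p′ q′ → p ≡ p′ ⊎ q ≡ q′

    star⇒rectangular : MissingIsStar F → ∀ S → S ⊆ᴱ Missing F → Rectangular S
    star⇒rectangular (inj₁ (x , row-x)) S S⊆M {i} {i′} {j} {j′} e e′ =
      subst (λ k → InS S k j) (trans (row-x i′ j (S⊆M i′ j e′)) (sym (row-x i j′ (S⊆M i j′ e)))) e′
    star⇒rectangular (inj₂ (y , col-y)) S S⊆M {i} {i′} {j} {j′} e e′ =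
      subst (InS S i) (trans (col-y i j′ (S⊆M i j′ e)) (sym (col-y i′ j (S⊆M i′ j e′)))) e

    -- Two disjoint missing edges form a set of missing edges that is not rectangular.
    rectangular⇒pairwiseIncident : (∀ S → S ⊆ᴱ Missing F → NonemptyE S → Rectangular S) → PairwiseIncident
    rectangular⇒pairwiseIncident rect {p} {p′} {q} {q′} m m′ with p ≟ᶠ p′ | q ≟ᶠ q′
    ... | yes p≡p′ | _ = inj₁ p≡p′
    ... | no _ | yes q≡q′ = inj₂ q≡q′
    ... | no p≢p′ | no q≢q′
      with Equivalence.to (InS-edgeSet Pair? p q′) (rect S S⊆M (p , q , pq∈S) pq∈S p′q′∈S)
      where
      Pair? : ∀ i → Decidable (λ j → (i ≡ p × j ≡ q) ⊎ (i ≡ p′ × j ≡ q′))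
      Pair? i j = ((i ≟ᶠ p) ×-dec (j ≟ᶠ q)) ⊎-dec ((i ≟ᶠ p′) ×-dec (j ≟ᶠ q′))
      S : EdgeSet a b
      S = edgeSet Pair?
      pq∈S : InS S p q
      pq∈S = Equivalence.from (InS-edgeSet Pair? p q) (inj₁ (refl , refl))
      p′q′∈S : InS S p′ q′
      p′q′∈S = Equivalence.from (InS-edgeSet Pair? p′ q′) (inj₂ (refl , refl))
      S⊆M : S ⊆ᴱ Missing F
      S⊆M i j e with Equivalence.to (InS-edgeSet Pair? i j) e
      ... | inj₁ (refl , refl) = m
      ... | inj₂ (refl , refl) = m′
    ... | inj₁ (_ , q′≡q) = ⊥-elim (q≢q′ (sym q′≡q))
    ... | inj₂ (p≡p′ , _) = ⊥-elim (p≢p′ p≡p′)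

    -- The vertex of A is only needed as a centre when no edge is missing.
    pairwiseIncident⇒star : Fin a → PairwiseIncident → MissingIsStar F
    pairwiseIncident⇒star x incident with any? (λ i → any? (Missing? i))
    ... | no none = inj₁ (x , λ i j m → ⊥-elim (none (i , j , m)))
    ... | yes (i₀ , j₀ , m₀) with any? (λ i → any? λ j → Missing? i j ×-dec ¬? (i ≟ᶠ i₀))
    ...   | no none = inj₁ (i₀ , λ i j m → decidable-stable (i ≟ᶠ i₀) λ i≢i₀ → none (i , j , m , i≢i₀))
    ...   | yes (i₁ , j₁ , m₁ , i₁≢i₀) with any? (λ i → any? λ j → Missing? i j ×-dec ¬? (j ≟ᶠ j₀))
    ...     | no none = inj₂ (j₀ , λ i j m → decidable-stable (j ≟ᶠ j₀) λ j≢j₀ → none (i , j , m , j≢j₀))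
    ...     | yes (i₂ , j₂ , m₂ , j₂≢j₀) = ⊥-elim (i₁≢i₀ (trans i₁≡i₂ (sym i₀≡i₂)))
      where
      j₀≡j₁ : j₀ ≡ j₁
      j₀≡j₁ = [ (λ i₀≡i₁ → ⊥-elim (i₁≢i₀ (sym i₀≡i₁))) , (λ e → e) ]′ (incident m₀ m₁)
      i₀≡i₂ : i₀ ≡ i₂
      i₀≡i₂ = [ (λ e → e) , (λ j₀≡j₂ → ⊥-elim (j₂≢j₀ (sym j₀≡j₂))) ]′ (incident m₀ m₂)
      i₁≡i₂ : i₁ ≡ i₂
      i₁≡i₂ = [ (λ e → e) , (λ j₁≡j₂ → ⊥-elim (j₂≢j₀ (sym (trans j₀≡j₁ j₁≡j₂)))) ]′ (incident m₁ m₂)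

  allEdgeSets : ∀ a b → List (EdgeSet a b)
  allEdgeSets a b = allVecs (allVecs bools b) a

  ∈-allEdgeSets : ∀ {a b} (S : EdgeSet a b) → S ∈ allEdgeSets a b
  ∈-allEdgeSets = ∈-allVecs (∈-allVecs ∈-bools)

  module _ {a b : ℕ} (F : Graph a b) where

    NonemptyMissingSubset? : Decidable (λ S → S ⊆ᴱ Missing F × NonemptyE S)
    NonemptyMissingSubset? = ⊆ᴱ? (Missing? F) ∩? NonemptyE?

    numNonemptyMissingSubsets : ℕ
    numNonemptyMissingSubsets = count NonemptyMissingSubset? (allEdgeSets a b)

    2^numMissing≡numNonemptyMissingSubsets+1 : 2 ^ numMissing F ≡ numNonemptyMissingSubsets + 1
    2^numMissing≡numNonemptyMissingSubsets+1 = sym (begin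
      numNonemptyMissingSubsets + 1
        ≡⟨ cong (numNonemptyMissingSubsets +_) empty-only ⟨
      numNonemptyMissingSubsets + count (⊆ᴱ? (Missing? F) ∩? ∁? NonemptyE?) (allEdgeSets a b)
        ≡⟨ count-partition (⊆ᴱ? (Missing? F)) NonemptyE? (allEdgeSets a b) ⟨
      count (⊆ᴱ? (Missing? F)) (allEdgeSets a b)
        ≡⟨ count-edgeSubsets a b (Missing? F) ⟩
      2 ^ numMissing F ∎)
      where
      open ≡-Reasoning
      empty-only : count (⊆ᴱ? (Missing? F) ∩? ∁? NonemptyE?) (allEdgeSets a b) ≡ 1
      empty-only = begin
        count (⊆ᴱ? (Missing? F) ∩? ∁? NonemptyE?) (allEdgeSets a b)
          ≡⟨ count-cong _ (⊆ᴱ? (λ _ → ∅?)) (allEdgeSets a b) (λ _ → mk⇔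
               (λ (_ , empty) i j e → empty (i , j , e))
               (λ S⊆∅ → (λ i j e → ⊥-elim (S⊆∅ i j e)) , λ (i , j , e) → S⊆∅ i j e)) ⟩
        count (⊆ᴱ? (λ _ → ∅?)) (allEdgeSets a b)
          ≡⟨ count-edgeSubsets a b (λ _ → ∅?) ⟩
        2 ^ count (λ ij → ∅? (proj₂ ij)) (cartesianProduct (allFin a) (allFin b))
          ≡⟨ cong (2 ^_) (count-none _ (cartesianProduct (allFin a) (allFin b)) λ _ ()) ⟩
        1 ∎

    counted⇔ : ∀ S → Counted F S ⇔ ((S ⊆ᴱ Missing F × NonemptyE S) × Rectangular S)
    counted⇔ S = mk⇔
      (λ (S⊆M , ne , cb) → (S⊆M , ne) , proj₂ (Equivalence.to (isCompleteBipartite⇔nonempty×rectangular S) cb))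
      (λ ((S⊆M , ne) , rect) → S⊆M , ne , Equivalence.from (isCompleteBipartite⇔nonempty×rectangular S) (ne , rect))

    numBipartiteSubsets≤ : numBipartiteSubsets F ≤ numNonemptyMissingSubsets
    numBipartiteSubsets≤ = count-mono (counted? F) NonemptyMissingSubset? (allEdgeSets a b)
      λ {S} _ → proj₁ ∘ Equivalence.to (counted⇔ S)

    numBipartiteSubsets≡⇔star : Fin a → numBipartiteSubsets F ≡ numNonemptyMissingSubsets ⇔ MissingIsStar F
    numBipartiteSubsets≡⇔star x = mk⇔
      (λ s≡T → pairwiseIncident⇒star F x (rectangular⇒pairwiseIncident F λ S S⊆M ne →
         proj₂ (Equivalence.to (counted⇔ S)
           (count-mono-≡⇒⊇ (counted? F) NonemptyMissingSubset? (allEdgeSets a b)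
              (λ {S} _ → proj₁ ∘ Equivalence.to (counted⇔ S)) s≡T (∈-allEdgeSets S) (S⊆M , ne)))))
      (λ star → ≤-antisym numBipartiteSubsets≤
         (count-mono NonemptyMissingSubset? (counted? F) (allEdgeSets a b) λ {S} _ S∈ →
            Equivalence.from (counted⇔ S) (S∈ , star⇒rectangular F star S (proj₁ S∈))))

  Avoids? : ∀ {n} (x : Fin n) → Decidable (λ (X : Vec Bool n) → lookup X x ≡ false)
  Avoids? x X = lookup X x ≟ᵇ false

  count-all-subsets : ∀ n → count U? (allVecs bools n) ≡ 2 ^ n
  count-all-subsets zero = refl
  count-all-subsets (suc n) =
    trans (count-allVecs-suc {n = n} U? U? U? (λ _ _ → mk⇔ _ _) bools)
          (cong (2 *_) (count-all-subsets n))

  count-avoiding : ∀ n (x : Fin (suc n)) → count (Avoids? x) (allVecs bools (suc n)) ≡ 2 ^ n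
  count-avoiding n fzero =
    trans (count-allVecs-suc {n = n} (_≟ᵇ false) U? (Avoids? fzero) (λ _ _ → mk⇔ (_, tt) proj₁) bools)
          (trans (+-identityʳ _) (count-all-subsets n))
  count-avoiding (suc n) (fsuc x) =
    trans (count-allVecs-suc U? (Avoids? x) (Avoids? (fsuc x)) (λ _ _ → mk⇔ (tt ,_) proj₂) bools)
          (cong (2 *_) (count-avoiding n x))

  numNonemptyAvoiding : ∀ {n} → Fin n → ℕ
  numNonemptyAvoiding {n} x = count (Avoids? x ∩? NonemptyV?) (allVecs bools n)

  count-avoiding≡nonempty+1 : ∀ {n} (x : Fin n) → count (Avoids? x) (allVecs bools n) ≡ numNonemptyAvoiding x + 1
  count-avoiding≡nonempty+1 {n} x =
    trans (count-partition (Avoids? x) NonemptyV? (allVecs bools n)) (cong (numNonemptyAvoiding x +_) empty-only)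
    where
    empty-only : count (Avoids? x ∩? ∁? NonemptyV?) (allVecs bools n) ≡ 1
    empty-only = begin
      count (Avoids? x ∩? ∁? NonemptyV?) (allVecs bools n)
        ≡⟨ count-cong _ (⊆ᵛ? ∅?) (allVecs bools n) (λ _ → mk⇔
             (λ (_ , empty) j j∈X → empty (j , j∈X))
             (λ X⊆∅ → ¬-not (X⊆∅ x) , λ (j , j∈X) → X⊆∅ j j∈X)) ⟩
      count (⊆ᵛ? ∅?) (allVecs bools n)
        ≡⟨ count-subsets n ∅? ⟩
      2 ^ count ∅? (allFin n)
        ≡⟨ cong (2 ^_) (count-none ∅? (allFin n) λ _ ()) ⟩
      1 ∎
      where open ≡-Reasoning

  allSubsetPairs : ∀ a b → List (Vec Bool a × Vec Bool b)
  allSubsetPairs a b = cartesianProduct (allVecs bools a) (allVecs bools b)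

  allSubsetPairs-unique : ∀ a b → Unique (allSubsetPairs a b)
  allSubsetPairs-unique a b = Unique.cartesianProduct⁺ (allVecs-unique bools-unique a) (allVecs-unique bools-unique b)

  ∈-allSubsetPairs : ∀ {a b} (XY : Vec Bool a × Vec Bool b) → XY ∈ allSubsetPairs a b
  ∈-allSubsetPairs (X , Y) = ∈-cartesianProduct⁺ (∈-allVecs ∈-bools X) (∈-allVecs ∈-bools Y)


  BothNonempty? : ∀ {a b} →
    Decidable (λ (XY : Vec Bool a × Vec Bool b) → NonemptyV (proj₁ XY) × NonemptyV (proj₂ XY))
  BothNonempty? XY = NonemptyV? (proj₁ XY) ×-dec NonemptyV? (proj₂ XY)

  module _ {a b : ℕ} (F : Graph a b) (x : Fin a) (y : Fin b) where

    Admissible : Vec Bool a × Vec Bool b → Set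
    Admissible XY = lookup (proj₁ XY) x ≡ false × lookup (proj₂ XY) y ≡ false
                  × (∀ i j → In (proj₁ XY) i → In (proj₂ XY) j → Missing F i j)

    Admissible? : Decidable Admissible
    Admissible? XY = Avoids? x (proj₁ XY) ×-dec Avoids? y (proj₂ XY) ×-dec
      all? λ i → all? λ j → In? (proj₁ XY) i →-dec (In? (proj₂ XY) j →-dec Missing? F i j)

    count-admissible-nonempty : (∀ j → Edge F x j) → (∀ i → Edge F i y) →
      count (Admissible? ∩? BothNonempty?) (allSubsetPairs a b) ≡ numBipartiteSubsets F
    count-admissible-nonempty x-full y-full =
      count-bijection (Admissible? ∩? BothNonempty?) (counted? F) (allSubsetPairs a b) (allEdgeSets a b)
        (λ XY → outer (proj₁ XY) (proj₂ XY)) (λ S → rowSupport S , colSupport S)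
        (allSubsetPairs-unique a b) (allVecs-unique (allVecs-unique bools-unique b) a) into onto
      where
      into : ∀ {XY} → XY ∈ allSubsetPairs a b → Admissible XY × NonemptyV (proj₁ XY) × NonemptyV (proj₂ XY) → _
      into {X , Y} _ ((_ , _ , X×Y⊆M) , neX@(i , i∈X) , neY@(j , j∈Y)) =
        ∈-allEdgeSets (outer X Y) ,
        Equivalence.from (counted⇔ F (outer X Y))
          (((λ i j e → let i∈ , j∈ = Equivalence.to (InS-outer X Y i j) e in X×Y⊆M i j i∈ j∈) ,
            (i , j , Equivalence.from (InS-outer X Y i j) (i∈X , j∈Y))) ,
           outer-rectangular X Y) ,
        cong₂ _,_ (rowSupport-outer X {Y} neY) (colSupport-outer {X = X} Y neX)
      onto : ∀ {S} → S ∈ allEdgeSets a b → Counted F S → _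
      onto {S} _ counted with Equivalence.to (counted⇔ F S) counted
      ... | (S⊆M , i , j , e) , rect =
        ∈-allSubsetPairs (rowSupport S , colSupport S) ,
        ((¬-not (λ r → let j′ , e′ = Equivalence.to (In-rowSupport S x) r in not-¬ (x-full j′) (S⊆M x j′ e′)) ,
          ¬-not (λ c → let i′ , e′ = Equivalence.to (In-colSupport S y) c in not-¬ (y-full i′) (S⊆M i′ y e′)) ,
          (λ i j r c → S⊆M i j (supports⊆S r c))) ,
         (i , Equivalence.from (In-rowSupport S i) (j , e)) ,
         (j , Equivalence.from (In-colSupport S j) (i , e))) ,
        sym (rectangular⇒outer-supports S rect)
        where
        supports⊆S : ∀ {i j} → In (rowSupport S) i → In (colSupport S) j → InS S i j
        supports⊆S {i} {j} r c =
          rect (proj₂ (Equivalence.to (In-rowSupport S i) r)) (proj₂ (Equivalence.to (In-colSupport S j) c))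

    numAdmissible : ℕ
    numAdmissible = count Admissible? (allSubsetPairs a b)

    admissible-decomposition : (∀ j → Edge F x j) → (∀ i → Edge F i y) →
      numAdmissible + numNonemptyAvoiding x * numNonemptyAvoiding y
        ≡ numBipartiteSubsets F + (numNonemptyAvoiding x + 1) * (numNonemptyAvoiding y + 1)
    admissible-decomposition x-full y-full = begin
      numAdmissible + Cx * Cy
        ≡⟨ cong (_+ Cx * Cy) (count-partition Admissible? BothNonempty? XYs) ⟩
      (count (Admissible? ∩? BothNonempty?) XYs + count (Admissible? ∩? ∁? BothNonempty?) XYs) + Cx * Cy
        ≡⟨ cong₂ (λ u v → (u + v) + Cx * Cy) (count-admissible-nonempty x-full y-full) admissible-degenerate ⟩
      (s + K) + Cx * Cy
        ≡⟨ trans (+-assoc s K (Cx * Cy)) (cong (s +_) (+-comm K (Cx * Cy))) ⟩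
      s + (Cx * Cy + K)
        ≡⟨ cong (λ u → s + (u + K)) avoiding-nonempty ⟨
      s + (count (Avoiding? ∩? BothNonempty?) XYs + K)
        ≡⟨ cong (s +_) (count-partition Avoiding? BothNonempty? XYs) ⟨
      s + count Avoiding? XYs
        ≡⟨ cong (s +_) (count-cartesianProduct (Avoids? x) (Avoids? y) (allVecs bools a) (allVecs bools b)) ⟩
      s + count (Avoids? x) (allVecs bools a) * count (Avoids? y) (allVecs bools b)
        ≡⟨ cong (s +_) (cong₂ _*_ (count-avoiding≡nonempty+1 x) (count-avoiding≡nonempty+1 y)) ⟩
      s + (Cx + 1) * (Cy + 1) ∎
      where
      open ≡-Reasoning
      XYs : List (Vec Bool a × Vec Bool b)
      XYs = allSubsetPairs a b
      s Cx Cy : ℕ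
      s = numBipartiteSubsets F
      Cx = numNonemptyAvoiding x
      Cy = numNonemptyAvoiding y
      Avoiding? : Decidable (λ (XY : Vec Bool a × Vec Bool b) →
                               lookup (proj₁ XY) x ≡ false × lookup (proj₂ XY) y ≡ false)
      Avoiding? XY = Avoids? x (proj₁ XY) ×-dec Avoids? y (proj₂ XY)
      K : ℕ
      K = count (Avoiding? ∩? ∁? BothNonempty?) XYs
      admissible-degenerate : count (Admissible? ∩? ∁? BothNonempty?) XYs ≡ count (Avoiding? ∩? ∁? BothNonempty?) XYs
      admissible-degenerate = count-cong _ _ XYs λ _ → mk⇔
        (λ ((x∉ , y∉ , _) , degenerate) → (x∉ , y∉) , degenerate)
        (λ ((x∉ , y∉) , degenerate) →
           (x∉ , y∉ , λ i j i∈ j∈ → ⊥-elim (degenerate ((i , i∈) , (j , j∈)))) , degenerate)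
      avoiding-nonempty : count (Avoiding? ∩? BothNonempty?) XYs ≡ Cx * Cy
      avoiding-nonempty = trans
        (count-cong _ (λ XY → (Avoids? x ∩? NonemptyV?) (proj₁ XY) ×-dec (Avoids? y ∩? NonemptyV?) (proj₂ XY))
           XYs λ _ → mk⇔
          (λ ((x∉ , y∉) , neX , neY) → (x∉ , neX) , (y∉ , neY))
          (λ ((x∉ , neX) , (y∉ , neY)) → (x∉ , y∉) , neX , neY))
        (count-cartesianProduct (Avoids? x ∩? NonemptyV?) (Avoids? y ∩? NonemptyV?) (allVecs bools a) (allVecs bools b))

    numAdmissible≡ : (∀ j → Edge F x j) → (∀ i → Edge F i y) →
      numAdmissible ≡ numBipartiteSubsets F + numNonemptyAvoiding x + numNonemptyAvoiding y + 1
    numAdmissible≡ x-full y-full = +-cancelʳ-≡ (Cx * Cy) _ _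
      (trans (admissible-decomposition x-full y-full) (expand (numBipartiteSubsets F) Cx Cy))
      where
      Cx Cy : ℕ
      Cx = numNonemptyAvoiding x
      Cy = numNonemptyAvoiding y
      expand : ∀ s cx cy → s + (cx + 1) * (cy + 1) ≡ s + cx + cy + 1 + cx * cy
      expand = solve-∀

  -- Proper 3-colourings

  third : Fin 3 → Fin 3 → Fin 3
  third fzero (fsuc fzero) = fsuc (fsuc fzero)
  third fzero (fsuc (fsuc fzero)) = fsuc fzero
  third (fsuc fzero) fzero = fsuc (fsuc fzero)
  third (fsuc fzero) (fsuc (fsuc fzero)) = fzero
  third (fsuc (fsuc fzero)) fzero = fsuc fzero
  third (fsuc (fsuc fzero)) (fsuc fzero) = fzero
  third _ _ = fzero -- junk: α ≡ β

  third-≢ˡ : ∀ α β → α ≢ β → third α β ≢ α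
  third-≢ˡ = toWitness {a? = all? λ α → all? λ β → ¬? (α ≟ᶠ β) →-dec ¬? (third α β ≟ᶠ α)} _

  third-≢ʳ : ∀ α β → α ≢ β → third α β ≢ β
  third-≢ʳ = toWitness {a? = all? λ α → all? λ β → ¬? (α ≟ᶠ β) →-dec ¬? (third α β ≟ᶠ β)} _

  three-colours : ∀ α β → α ≢ β → ∀ u → u ≡ α ⊎ u ≡ β ⊎ u ≡ third α β
  three-colours = toWitness
    {a? = all? λ α → all? λ β → ¬? (α ≟ᶠ β) →-dec all? λ u → (u ≟ᶠ α) ⊎-dec (u ≟ᶠ β) ⊎-dec (u ≟ᶠ third α β)} _

  colourClass : ∀ {n} → Fin 3 → Vec (Fin 3) n → Vec Bool n
  colourClass γ = Vec.map λ u → does (u ≟ᶠ γ)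

  paint : ∀ {n} → Fin 3 → Fin 3 → Vec Bool n → Vec (Fin 3) n
  paint γ α = Vec.map λ t → if t then γ else α

  In-colourClass : ∀ {n} γ (c : Vec (Fin 3) n) (i : Fin n) → In (colourClass γ c) i ⇔ lookup c i ≡ γ
  In-colourClass γ c i =
    subst (λ u → u ≡ true ⇔ lookup c i ≡ γ) (sym (VecP.lookup-map i _ c)) (does-true⇔ (lookup c i ≟ᶠ γ))

  module _ {n : ℕ} (γ α : Fin 3) where

    paint-colourClass : (c : Vec (Fin 3) n) → (∀ i → lookup c i ≡ α ⊎ lookup c i ≡ γ) →
      paint γ α (colourClass γ c) ≡ c
    paint-colourClass c two-coloured = Pointwise-≡⇒≡ (ext λ i →
      trans (VecP.lookup-map i _ (colourClass γ c)) (trans (cong (if_then γ else α) (VecP.lookup-map i _ c)) (painted i)))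
      where
      painted : ∀ i → (if does (lookup c i ≟ᶠ γ) then γ else α) ≡ lookup c i
      painted i with lookup c i ≟ᶠ γ | two-coloured i
      ... | yes ci≡γ | _ = sym ci≡γ
      ... | no _ | inj₁ ci≡α = sym ci≡α
      ... | no ci≢γ | inj₂ ci≡γ = ⊥-elim (ci≢γ ci≡γ)

    colourClass-paint : α ≢ γ → (X : Vec Bool n) → colourClass γ (paint γ α X) ≡ X
    colourClass-paint α≢γ X = Pointwise-≡⇒≡ (ext λ i →
      trans (VecP.lookup-map i _ (paint γ α X))
            (trans (cong (λ u → does (u ≟ᶠ γ)) (VecP.lookup-map i _ X)) (classified (lookup X i))))
      where
      classified : ∀ t → does ((if t then γ else α) ≟ᶠ γ) ≡ t
      classified true = dec-true (γ ≟ᶠ γ) refl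
      classified false = dec-false (α ≟ᶠ γ) α≢γ

    lookup-paint : (X : Vec Bool n) (i : Fin n) → lookup (paint γ α X) i ≡ (if lookup X i then γ else α)
    lookup-paint X i = VecP.lookup-map i _ X

  colourPairs : List (Fin 3 × Fin 3)
  colourPairs = cartesianProduct (allFin 3) (allFin 3)

  Distinct? : Decidable (λ (αβ : Fin 3 × Fin 3) → proj₁ αβ ≢ proj₂ αβ)
  Distinct? αβ = ¬? (proj₁ αβ ≟ᶠ proj₂ αβ)

  module _ {a b : ℕ} (F : Graph a b) (x : Fin a) (y : Fin b) where

    ColourClasses : Set
    ColourClasses = (Fin 3 × Fin 3) × (Vec Bool a × Vec Bool b)

    Valid? : Decidable (λ (p : ColourClasses) → proj₁ (proj₁ p) ≢ proj₂ (proj₁ p) × Admissible F x y (proj₂ p))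
    Valid? p = Distinct? (proj₁ p) ×-dec Admissible? F x y (proj₂ p)

    classesFrom : Fin 3 → Fin 3 → Coloring a b → ColourClasses
    classesFrom α β (c , d) = (α , β) , colourClass (third α β) c , colourClass (third α β) d

    classes : Coloring a b → ColourClasses
    classes (c , d) = classesFrom (lookup c x) (lookup d y) (c , d)

    painting : ColourClasses → Coloring a b
    painting ((α , β) , X , Y) = paint (third α β) α X , paint (third α β) β Y

    painting-proper : ∀ α β X Y → α ≢ β → (∀ i j → In X i → In Y j → Missing F i j) →
      Proper F (painting ((α , β) , X , Y))
    painting-proper α β X Y α≢β X×Y⊆M i j fij same =
      differ (lookup X i) (lookup Y j) refl refl (trans (sym (lookup-paint γ α X i)) (trans same (lookup-paint γ β Y j)))
      where
      γ : Fin 3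
      γ = third α β
      differ : ∀ u v → lookup X i ≡ u → lookup Y j ≡ v → (if u then γ else α) ≢ (if v then γ else β)
      differ true true i∈X j∈Y _ = not-¬ fij (X×Y⊆M i j i∈X j∈Y)
      differ true false _ _ = third-≢ʳ α β α≢β
      differ false true _ _ = third-≢ˡ α β α≢β ∘ sym
      differ false false _ _ = α≢β

    numColorings≡count-valid : (∀ j → Edge F x j) → (∀ i → Edge F i y) →
      numColorings F ≡ count Valid? (cartesianProduct colourPairs (allSubsetPairs a b))
    numColorings≡count-valid x-full y-full =
      count-bijection (proper? F) Valid? (allColorings a b) (cartesianProduct colourPairs (allSubsetPairs a b)) classes painting
        (Unique.cartesianProduct⁺ (allVecs-unique (Unique.allFin⁺ 3) a) (allVecs-unique (Unique.allFin⁺ 3) b))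
        (Unique.cartesianProduct⁺ (Unique.cartesianProduct⁺ (Unique.allFin⁺ 3) (Unique.allFin⁺ 3))
                                  (allSubsetPairs-unique a b))
        into onto
      where
      into : ∀ {cd} → cd ∈ allColorings a b → Proper F cd → _
      into {c , d} _ proper =
        ∈-cartesianProduct⁺ (∈-cartesianProduct⁺ (∈-allFin α) (∈-allFin β)) (∈-allSubsetPairs _) ,
        (α≢β ,
         ¬-not (λ r → third-≢ˡ α β α≢β (sym (Equivalence.to (In-colourClass γ c x) r))) ,
         ¬-not (λ s → third-≢ʳ α β α≢β (sym (Equivalence.to (In-colourClass γ d y) s))) ,
         λ i j r s → ¬-not λ fij → proper i j fij
           (trans (Equivalence.to (In-colourClass γ c i) r) (sym (Equivalence.to (In-colourClass γ d j) s)))) ,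
        cong₂ _,_ (paint-colourClass γ α c A-side) (paint-colourClass γ β d B-side)
        where
        α β γ : Fin 3
        α = lookup c x
        β = lookup d y
        γ = third α β
        α≢β : α ≢ β
        α≢β = proper x y (x-full y)
        A-side : ∀ i → lookup c i ≡ α ⊎ lookup c i ≡ γ
        A-side i with three-colours α β α≢β (lookup c i)
        ... | inj₁ ci≡α = inj₁ ci≡α
        ... | inj₂ (inj₁ ci≡β) = ⊥-elim (proper i y (y-full i) ci≡β)
        ... | inj₂ (inj₂ ci≡γ) = inj₂ ci≡γ
        B-side : ∀ j → lookup d j ≡ β ⊎ lookup d j ≡ γ
        B-side j with three-colours α β α≢β (lookup d j)
        ... | inj₁ dj≡α = ⊥-elim (proper x j (x-full j) (sym dj≡α))
        ... | inj₂ (inj₁ dj≡β) = inj₁ dj≡β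
        ... | inj₂ (inj₂ dj≡γ) = inj₂ dj≡γ
      onto : ∀ {p} → p ∈ cartesianProduct colourPairs (allSubsetPairs a b) → _ → _
      onto {(α , β) , X , Y} _ (α≢β , x∉X , y∉Y , X×Y⊆M) =
        ∈-cartesianProduct⁺ (∈-allVecs ∈-allFin _) (∈-allVecs ∈-allFin _) ,
        painting-proper α β X Y α≢β X×Y⊆M ,
        trans (cong₂ (λ α′ β′ → classesFrom α′ β′ (painting p)) (painted-at X x x∉X) (painted-at Y y y∉Y))
              (cong ((α , β) ,_) (cong₂ _,_ (colourClass-paint γ α (third-≢ˡ α β α≢β ∘ sym) X)
                                            (colourClass-paint γ β (third-≢ʳ α β α≢β ∘ sym) Y)))
        where
        p : ColourClasses
        p = (α , β) , X , Y
        γ : Fin 3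
        γ = third α β
        painted-at : ∀ {n δ} (Z : Vec Bool n) k → lookup Z k ≡ false → lookup (paint γ δ Z) k ≡ δ
        painted-at {δ = δ} Z k k∉Z = trans (lookup-paint γ δ Z k) (cong (if_then γ else δ) k∉Z)

    numColorings≡6*numAdmissible : (∀ j → Edge F x j) → (∀ i → Edge F i y) →
      numColorings F ≡ 6 * numAdmissible F x y
    numColorings≡6*numAdmissible x-full y-full =
      trans (numColorings≡count-valid x-full y-full)
            (count-cartesianProduct Distinct? (Admissible? F x y) colourPairs (allSubsetPairs a b))

  2^suc≡2*[numNonemptyAvoiding+1] : ∀ {n} (x : Fin (suc n)) → 2 ^ suc n ≡ 2 * (numNonemptyAvoiding x + 1)
  2^suc≡2*[numNonemptyAvoiding+1] {n} x = cong (2 *_) (trans (sym (count-avoiding n x)) (count-avoiding≡nonempty+1 x))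

open Counting
import Data.Nat as ℕ
import Data.Nat.Properties as ℕ
open import Data.Nat using (ℕ; zero; suc; _<_; _⊔_; _^_)
open import Data.Fin using (Fin)
open import Data.Integer using (ℤ; +_; _+_; _-_; _*_; _≤_; +≤+)
open import Data.Integer.Properties using (pos-+; pos-*; +-injective)
open import Data.Integer.Solver using (module +-*-Solver)
open import Data.Product using (∃; _×_; _,_)
open import Relation.Binary.PropositionalEquality
open import Function using (_⇔_)
open import Function.Bundles using (mk⇔)
open import Function.Properties.Equivalence using () renaming (trans to ⇔-trans)

module _ (cx cy : ℕ) where

  open +-*-Solver

  sixfold : ℕ → ℕ
  sixfold u = 6 ℕ.* (u ℕ.+ cx ℕ.+ cy ℕ.+ 1)

  private
    +sixfold : ∀ u → + sixfold u ≡ + 6 * (+ u + + cx + + cy + + 1)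
    +sixfold u rewrite pos-* 6 (u ℕ.+ cx ℕ.+ cy ℕ.+ 1)
                     | pos-+ (u ℕ.+ cx ℕ.+ cy) 1 | pos-+ (u ℕ.+ cx) cy | pos-+ u cx = refl

    +double : ∀ c → + (2 ℕ.* (c ℕ.+ 1)) ≡ + 2 * (+ c + + 1)
    +double c rewrite pos-* 2 (c ℕ.+ 1) | pos-+ c 1 = refl

  bound-rhs≡sixfold : ∀ t →
    + 3 * + (2 ℕ.* (cx ℕ.+ 1)) + + 3 * + (2 ℕ.* (cy ℕ.+ 1)) + + 6 * (+ (t ℕ.+ 1) - + 2) ≡ + sixfold t
  bound-rhs≡sixfold t = begin
    + 3 * + (2 ℕ.* (cx ℕ.+ 1)) + + 3 * + (2 ℕ.* (cy ℕ.+ 1)) + + 6 * (+ (t ℕ.+ 1) - + 2)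
      ≡⟨ cong₂ (λ A B → + 3 * A + + 3 * B + + 6 * (+ (t ℕ.+ 1) - + 2)) (+double cx) (+double cy) ⟩
    + 3 * (+ 2 * (+ cx + + 1)) + + 3 * (+ 2 * (+ cy + + 1)) + + 6 * (+ (t ℕ.+ 1) - + 2)
      ≡⟨ cong (λ T → + 3 * (+ 2 * (+ cx + + 1)) + + 3 * (+ 2 * (+ cy + + 1)) + + 6 * (T - + 2)) (pos-+ t 1) ⟩
    + 3 * (+ 2 * (+ cx + + 1)) + + 3 * (+ 2 * (+ cy + + 1)) + + 6 * (+ t + + 1 - + 2)
      ≡⟨ solve 3 (λ T X Y → con (+ 3) :* (con (+ 2) :* (X :+ con (+ 1))) :+ con (+ 3) :* (con (+ 2) :* (Y :+ con (+ 1)))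
                             :+ con (+ 6) :* (T :+ con (+ 1) :- con (+ 2))
                          := con (+ 6) :* (T :+ X :+ Y :+ con (+ 1))) refl (+ t) (+ cx) (+ cy) ⟩
    + 6 * (+ t + + cx + + cy + + 1)
      ≡⟨ +sixfold t ⟨
    + sixfold t ∎
    where open ≡-Reasoning

  sixfold≡exact-rhs : ∀ s →
    + sixfold s ≡ + 3 * + (2 ℕ.* (cx ℕ.+ 1)) + + 3 * + (2 ℕ.* (cy ℕ.+ 1)) - + 6 + + 6 * + s
  sixfold≡exact-rhs s = trans (sym (bound-rhs≡sixfold s))
    (solve 3 (λ S A B → con (+ 3) :* A :+ con (+ 3) :* B :+ con (+ 6) :* (S :+ con (+ 1) :- con (+ 2))
                     := con (+ 3) :* A :+ con (+ 3) :* B :- con (+ 6) :+ con (+ 6) :* S)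
       refl (+ s) (+ (2 ℕ.* (cx ℕ.+ 1))) (+ (2 ℕ.* (cy ℕ.+ 1))))

  sixfold-mono : ∀ {s t} → s ℕ.≤ t → sixfold s ℕ.≤ sixfold t
  sixfold-mono s≤t = ℕ.*-monoʳ-≤ 6 (ℕ.+-monoˡ-≤ 1 (ℕ.+-monoˡ-≤ cy (ℕ.+-monoˡ-≤ cx s≤t)))

  sixfold-injective : ∀ {s t} → sixfold s ≡ sixfold t → s ≡ t
  sixfold-injective {s} {t} eq =
    ℕ.+-cancelʳ-≡ cx s t (ℕ.+-cancelʳ-≡ cy _ _ (ℕ.+-cancelʳ-≡ 1 _ _ (ℕ.*-cancelˡ-≡ _ _ 6 eq)))

  closed-forms : ∀ {n N A B R} s t → n ≡ 6 ℕ.* N → N ≡ s ℕ.+ cx ℕ.+ cy ℕ.+ 1 →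
    A ≡ 2 ℕ.* (cx ℕ.+ 1) → B ≡ 2 ℕ.* (cy ℕ.+ 1) → R ≡ t ℕ.+ 1 → s ℕ.≤ t →
    (+ n ≡ + 3 * + A + + 3 * + B - + 6 + + 6 * + s)
    × (+ n ≤ + 3 * + A + + 3 * + B + + 6 * (+ R - + 2))
    × ((+ n ≡ + 3 * + A + + 3 * + B + + 6 * (+ R - + 2)) ⇔ s ≡ t)
  closed-forms s t refl refl refl refl refl s≤t =
    sixfold≡exact-rhs s ,
    subst (+ sixfold s ≤_) (sym (bound-rhs≡sixfold t)) (+≤+ (sixfold-mono s≤t)) ,
    mk⇔ (λ eq → sixfold-injective (+-injective (trans eq (bound-rhs≡sixfold t))))
        (λ { refl → sym (bound-rhs≡sixfold t) })

lemma5p2 : (a b : ℕ) (F : Graph a b)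
    → numMissing F < a ⊔ b
    → (∃ λ (x : Fin a) → ∀ j → Edge F x j)
    → (∃ λ (y : Fin b) → ∀ i → Edge F i y)
    → (+ numColorings F ≡ + 3 * + (2 ^ a) + + 3 * + (2 ^ b) - + 6 + + 6 * + numBipartiteSubsets F)
    × (+ numColorings F ≤ + 3 * + (2 ^ a) + + 3 * + (2 ^ b) + + 6 * (+ (2 ^ numMissing F) - + 2))
    × ((+ numColorings F ≡ + 3 * + (2 ^ a) + + 3 * + (2 ^ b) + + 6 * (+ (2 ^ numMissing F) - + 2))
    ⇔ MissingIsStar F)
lemma5p2 zero b F _ (() , _) _
lemma5p2 (suc a) zero F _ _ (() , _)
lemma5p2 (suc a) (suc b) F _ (x , x-full) (y , y-full) =
  let exact , bound , s≡T⇔ =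
        closed-forms (numNonemptyAvoiding x) (numNonemptyAvoiding y)
          (numBipartiteSubsets F) (numNonemptyMissingSubsets F)
          (numColorings≡6*numAdmissible F x y x-full y-full) (numAdmissible≡ F x y x-full y-full)
          (2^suc≡2*[numNonemptyAvoiding+1] x) (2^suc≡2*[numNonemptyAvoiding+1] y)
          (2^numMissing≡numNonemptyMissingSubsets+1 F) (numBipartiteSubsets≤ F)
  in exact , bound , ⇔-trans s≡T⇔ (numBipartiteSubsets≡⇔star F x)
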